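{- Let $n,m$ be positive integers and let $A=(a_{ij})$ be a binary $n\times m$ matrix belonging to $\mathfrak{D}_{n\times m}$. Then there exist integers $s,t$ with $0\le s\le m$, $0\le t\le n$, such that $a_{11}=a_{12}=\cdots=a_{1s}=1$ and $a_{1,s+1}=\cdots=a_{1m}=0$, and $a_{11}=a_{21}=\cdots=a_{t1}=1$ and $a_{t+1,1}=\cdots=a_{n1}=0$. That is, the first row of $A$ consists of a (possibly empty) block of ones followed by a (possibly empty) block of zeros, and the same holds for the first column.
   Context: For a binary $n\times m$ matrix $A=(a_{ij})$, let $x_i=\sum_{j=1}^m a_{ij}2^{m-j}$ ($i=1,\dots,n$) and $y_j=\sum_{i=1}^n a_{ij}2^{n-i}$ ($j=1,\dots,m$). $\mathfrak{D}_{n\times m}$ is the set of binary $n\times m$ matrices with $x_1\ge x_2\ge\cdots\ge x_n$ and $y_1\ge y_2\ge\cdots\ge y_m$ (rows and columns sorted in lexicographically non-increasing order). -}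

module Defs where

open import Data.Nat using (ℕ; zero; suc; _+_; _*_; _^_; _≤_; _<_)
open import Data.Bool using (Bool; true; false)
open import Data.Fin using (Fin; toℕ)
import Data.Fin as F
open import Data.Product using (_×_; ∃-syntax)
open import Relation.Binary.PropositionalEquality using (_≡_)

-- A binary n×m matrix: entry (i , j) with 0-based indices i : Fin n, j : Fin m.
-- Paper's a_{ij} (1-based) is  A (i-1) (j-1).
BinMatrix : ℕ → ℕ → Set
BinMatrix n m = Fin n → Fin m → Bool

bit : Bool → ℕ
bit true  = 1
bit false = 0

binValue : (k : ℕ) → (Fin k → Bool) → ℕ
binValue zero    v = 0
binValue (suc k) v = bit (v F.zero) * 2 ^ k + binValue k (λ j → v (F.suc j))

rowVal : ∀ {n m} → BinMatrix n m → Fin n → ℕ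
rowVal {n} {m} A i = binValue m (A i)

colVal : ∀ {n m} → BinMatrix n m → Fin m → ℕ
colVal {n} {m} A j = binValue n (λ i → A i j)

InD : ∀ {n m} → BinMatrix n m → Set
InD {n} {m} A =
  (∀ (i i' : Fin n) → toℕ i' ≡ suc (toℕ i) → rowVal A i' ≤ rowVal A i) ×
  (∀ (j j' : Fin m) → toℕ j' ≡ suc (toℕ j) → colVal A j' ≤ colVal A j)

{-# OPTIONS --safe #-}
-- The leading bit of a k+1-bit string outweighs all the others (2^k > any k-bit
-- value), so in a non-increasing sequence of binary values a leading 0 can only be
-- followed by leading 0s. The first row of A consists of the leading bits of its
-- columns and the first column of the leading bits of its rows, so each is a block
-- of ones followed by a block of zeros.
module Submission where

open import Defs
open import Data.Nat using (ℕ; zero; suc; _≤_; _<_; _*_; _^_; z≤n; s≤s)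
open import Data.Nat.Properties using (≤-reflexive; ≤-trans; m≤m+n; +-mono-≤; +-mono-≤-<; *-identityˡ; <⇒≱)
open import Data.Bool using (Bool; true; false)
open import Data.Bool.Properties using (¬-not)
open import Data.Fin using (Fin; zero; suc; toℕ)
open import Data.Product using (_×_; ∃-syntax; _,_; proj₁; proj₂)
open import Function using (_∘_)
open import Relation.Binary.PropositionalEquality using (_≡_; refl; cong)

bit*2^k≤2^k : ∀ b k → bit b * 2 ^ k ≤ 2 ^ k
bit*2^k≤2^k true  k = ≤-reflexive (*-identityˡ (2 ^ k))
bit*2^k≤2^k false k = z≤n

binValue<2^k : ∀ k (v : Fin k → Bool) → binValue k v < 2 ^ k
binValue<2^k zero    v = s≤s z≤n
binValue<2^k (suc k) v =
  ≤-trans (+-mono-≤-< (bit*2^k≤2^k (v zero) k) (binValue<2^k k (v ∘ suc)))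
          (+-mono-≤ (≤-reflexive refl) (m≤m+n (2 ^ k) 0))

head-false⇒binValue<2^k : ∀ k (v : Fin (suc k) → Bool) → v zero ≡ false →
  binValue (suc k) v < 2 ^ k
head-false⇒binValue<2^k k v v₀ rewrite v₀ = binValue<2^k k (v ∘ suc)

head-true⇒2^k≤binValue : ∀ k (v : Fin (suc k) → Bool) → v zero ≡ true →
  2 ^ k ≤ binValue (suc k) v
head-true⇒2^k≤binValue k v v₀ rewrite v₀ = ≤-trans (m≤m+n (2 ^ k) 0) (m≤m+n _ _)

binValue-≤⇒head-false : ∀ k (v w : Fin (suc k) → Bool) →
  binValue (suc k) w ≤ binValue (suc k) v → v zero ≡ false → w zero ≡ false
binValue-≤⇒head-false k v w w≤v v₀ = ¬-not λ w₀ →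
  <⇒≱ (head-false⇒binValue<2^k k v v₀) (≤-trans (head-true⇒2^k≤binValue k w w₀) w≤v)

FalseStable : ∀ {k} → (Fin k → Bool) → Set
FalseStable {k} f = ∀ (j j' : Fin k) → toℕ j' ≡ suc (toℕ j) → f j ≡ false → f j' ≡ false

OnesThenZeros : ∀ {k} → (Fin k → Bool) → Set
OnesThenZeros {k} f = ∃[ s ] (s ≤ k) × (∀ (j : Fin k) →
  (toℕ j < s → f j ≡ true) × (s ≤ toℕ j → f j ≡ false))

FalseStable-tail : ∀ {k} {f : Fin (suc k) → Bool} → FalseStable f → FalseStable (f ∘ suc)
FalseStable-tail st j j' j'≡1+j = st (suc j) (suc j') (cong suc j'≡1+j)

FalseStable⇒all-false : ∀ {k} {f : Fin (suc k) → Bool} → FalseStable f →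
  f zero ≡ false → ∀ j → f j ≡ false
FalseStable⇒all-false       st f₀ zero    = f₀
FalseStable⇒all-false {suc k} st f₀ (suc j) =
  FalseStable⇒all-false (FalseStable-tail st) (st zero (suc zero) refl f₀) j

OnesThenZeros-cons : ∀ {k} {f : Fin (suc k) → Bool} → f zero ≡ true →
  OnesThenZeros (f ∘ suc) → OnesThenZeros f
OnesThenZeros-cons {k} {f} f₀ (s , s≤k , blocks) = suc s , s≤s s≤k , blocks′
  where
  blocks′ : ∀ (j : Fin (suc k)) → (toℕ j < suc s → f j ≡ true) × (suc s ≤ toℕ j → f j ≡ false)
  blocks′ zero    = (λ _ → f₀) , λ ()
  blocks′ (suc j) = (λ { (s≤s j<s) → proj₁ (blocks j) j<s })
                  , (λ { (s≤s s≤j) → proj₂ (blocks j) s≤j })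

FalseStable⇒OnesThenZeros : ∀ {k} (f : Fin k → Bool) → FalseStable f → OnesThenZeros f
FalseStable⇒OnesThenZeros {zero}  f st = 0 , z≤n , λ ()
FalseStable⇒OnesThenZeros {suc k} f st with f zero in f₀
... | false = 0 , z≤n , λ j → (λ ()) , (λ _ → FalseStable⇒all-false st f₀ j)
... | true  = OnesThenZeros-cons f₀ (FalseStable⇒OnesThenZeros (f ∘ suc) (FalseStable-tail st))

InD⇒firstRow-FalseStable : ∀ {n m} (A : BinMatrix (suc n) m) → InD A → FalseStable (A zero)
InD⇒firstRow-FalseStable {n} A (_ , cols) j j' j'≡1+j =
  binValue-≤⇒head-false n (λ i → A i j) (λ i → A i j') (cols j j' j'≡1+j)

InD⇒firstCol-FalseStable : ∀ {n m} (A : BinMatrix n (suc m)) → InD A →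
  FalseStable (λ i → A i zero)
InD⇒firstCol-FalseStable {m = m} A (rows , _) i i' i'≡1+i =
  binValue-≤⇒head-false m (A i) (A i') (rows i i' i'≡1+i)

proposition3 : (n m : ℕ) → (A : BinMatrix (suc n) (suc m)) → InD A →
    (∃[ s ] (s ≤ suc m) × (∀ (j : Fin (suc m)) →
        (toℕ j < s → A zero j ≡ true) × (s ≤ toℕ j → A zero j ≡ false))) ×
    (∃[ t ] (t ≤ suc n) × (∀ (i : Fin (suc n)) →
        (toℕ i < t → A i zero ≡ true) × (t ≤ toℕ i → A i zero ≡ false)))
proposition3 n m A A∈D =
  FalseStable⇒OnesThenZeros (A zero) (InD⇒firstRow-FalseStable A A∈D) ,
  FalseStable⇒OnesThenZeros (λ i → A i zero) (InD⇒firstCol-FalseStable A A∈D)
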